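{- Let $T$ be a text of length $n$ and $\theta\ge 2$ an integer. Consider a state (array $P$ and set $\mathcal{F}$ of created referencing factors) of the plcpcomp procedure with threshold $\theta$, and suppose a new referencing factor $F=T[i..i+\ell-1]$ with $\ell=P[i]$ is created, after which rules D and R are applied, yielding the array $P'$ and the factor set $\mathcal{F}\cup\{F\}$. Then every position that is a peak with respect to $(P',\mathcal{F}\cup\{F\})$ but was not a peak with respect to $(P,\mathcal{F})$ equals $i+\ell$, the position immediately following the end of $F$.
   Context: A text $T=T[1..n]$ is a string over an integer alphabet whose last character $T[n]=\$$ occurs nowhere else and is lexicographically smaller than all other characters; $T[i..]$ denotes the suffix starting at position $i$. For each position $i$, let $\Phi[i]$ be the starting position of the suffix that immediately precedes $T[i..]$ in the lexicographic order of all suffixes of $T$ (and $\Phi[i]:=n$ if $T[i..]$ is the smallest suffix), and let $\mathrm{PLCP}[i]$ be the length of the longest common prefix of $T[i..]$ and $T[\Phi[i]..]$ (and $0$ if $T[i..]$ is the smallest suffix). The plcpcomp procedure with threshold $\theta$ maintains a rewritable integer array $P[1..n]$, initially $P=\mathrm{PLCP}$, and a set of referencing factors, initially empty. It repeats: (1) let $i$ be the leftmost position with $P[i]\ge P[j]$ for all $j$; (2) if $P[i]<\theta$, stop; (3) create the referencing factor $T[i..i+P[i]-1]$ with reference $(\Phi[i],P[i])$; (4) with $\ell:=P[i]$ (value before this step), set $P[j]\gets\min(P[j],i-j)$ for every $j\in[i-\ell,i)$ (rule D) and set $P[i+k]\gets 0$ for every $k\in[0,\ell)$ (rule R); then repeat.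 With respect to a state (current array $P$ and current set of created referencing factors), a position $i$ is a peak if $P[i]\ge\theta$ and at least one of the following holds: $i=1$; $P[i-1]<P[i]$; some created referencing factor ends at position $i-1$. -}

module Defs where

open import Data.Nat using (ℕ; zero; suc; _+_; _∸_; _≤_; _<_; _≡ᵇ_; _⊓_; _<ᵇ_; _≤ᵇ_)
open import Data.Bool using (Bool; true; false; if_then_else_; _∧_)
open import Data.List using (List; []; _∷_; _++_; [_]; drop; length)
open import Data.List.Relation.Unary.All using (All)
open import Data.List.Relation.Unary.Any using (Any)
open import Data.Product using (Σ; ∃; _×_; _,_; proj₁; proj₂)
open import Data.Sum using (_⊎_)
open import Relation.Nullary using (¬_)
open import Relation.Binary.PropositionalEquality using (_≡_)

-- Texts: lists of naturals (integer alphabet) whose last character ($)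
-- occurs nowhere else and is smaller than all other characters.
-- Positions are 1-indexed: T[1..n], n = length T.

ValidText : List ℕ → Set
ValidText T = Σ (List ℕ) λ body → Σ ℕ λ d → (T ≡ body ++ [ d ]) × All (d <_) body

suf : List ℕ → ℕ → List ℕ
suf T i = drop (i ∸ 1) T

data _<ˡ_ : List ℕ → List ℕ → Set where
  []<∷   : ∀ {y ys} → [] <ˡ (y ∷ ys)
  head<  : ∀ {x y xs ys} → x < y → (x ∷ xs) <ˡ (y ∷ ys)
  tail<  : ∀ {x xs ys} → xs <ˡ ys → (x ∷ xs) <ˡ (x ∷ ys)

lcp : List ℕ → List ℕ → ℕ
lcp (x ∷ xs) (y ∷ ys) = if x ≡ᵇ y then suc (lcp xs ys) else 0
lcp _ _ = 0

IsPos : List ℕ → ℕ → Set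
IsPos T p = (1 ≤ p) × (p ≤ length T)

IsPred : List ℕ → ℕ → ℕ → Set
IsPred T i j =
  IsPos T j × (suf T j <ˡ suf T i) ×
  (∀ k → IsPos T k → suf T k <ˡ suf T i → ¬ (suf T j <ˡ suf T k))

IsSmallest : List ℕ → ℕ → Set
IsSmallest T i = ∀ k → IsPos T k → ¬ (suf T k <ˡ suf T i)

IsPhi : List ℕ → ℕ → ℕ → Set
IsPhi T i j = IsPred T i j ⊎ (IsSmallest T i × j ≡ length T)

IsPLCP : List ℕ → ℕ → ℕ → Set
IsPLCP T i v =
  (Σ ℕ λ j → IsPred T i j × v ≡ lcp (suf T i) (suf T j)) ⊎ (IsSmallest T i × v ≡ 0)

-- States of plcpcomp: the array P (positions 1..n are meaningful) and the
-- list of created referencing factors (start position i, length ℓ,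
-- reference (Φ[i], ℓ)).

record RefFactor : Set where
  constructor factor
  field
    start  : ℕ
    len    : ℕ
    refPos : ℕ
    refLen : ℕ
open RefFactor public

State : Set
State = (ℕ → ℕ) × List RefFactor

-- Rules D and R applied for a factor starting at i with ℓ = P[i]:
--   j ∈ [i, i+ℓ)       : P[j] ← 0                (rule R)
--   j ∈ [i-ℓ, i)       : P[j] ← min(P[j], i-j)   (rule D)
updateP : (ℕ → ℕ) → ℕ → ℕ → (ℕ → ℕ)
updateP P i ℓ j =
  if (i ≤ᵇ j) ∧ (j <ᵇ i + ℓ) then 0
  else if (i ≤ᵇ j + ℓ) ∧ (j <ᵇ i) then P j ⊓ (i ∸ j)
  else P j

LeftmostMax : List ℕ → (ℕ → ℕ) → ℕ → Set
LeftmostMax T P i =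
  IsPos T i × (∀ j → IsPos T j → P j ≤ P i) × (∀ j → 1 ≤ j → j < i → P j < P i)

data Step (θ : ℕ) (T : List ℕ) (i : ℕ) : State → State → Set where
  step : ∀ {P F φ} → LeftmostMax T P i → θ ≤ P i → IsPhi T i φ →
         Step θ T i (P , F) (updateP P i (P i) , factor i (P i) φ (P i) ∷ F)

data Reachable (θ : ℕ) (T : List ℕ) : State → Set where
  init : ∀ {P} → (∀ i → IsPos T i → IsPLCP T i (P i)) → Reachable θ T (P , [])
  next : ∀ {s s' i} → Reachable θ T s → Step θ T i s s' → Reachable θ T s'

Peak : ℕ → List ℕ → State → ℕ → Set
Peak θ T (P , F) j =
  IsPos T j × θ ≤ P j ×
  (j ≡ 1 ⊎ P (j ∸ 1) < P j ⊎ Any (λ f → start f + len f ≡ j) F)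

module Submission where

-- The statement is a purely local fact about the update P' = updateP P i ℓ
-- (rules D and R).

open import Defs
open import Data.Nat using (ℕ; _+_; _≤_; _<_; _∸_; _⊓_; _≤ᵇ_; _<ᵇ_; z≤n; s≤s)
open import Data.Nat.Properties
open import Data.Bool using (true; false)
open import Data.List using (List; _∷_)
open import Data.List.Relation.Unary.Any using (Any; here; there)
open import Data.Product using (proj₁; _,_)
open import Data.Sum using (_⊎_; inj₁; inj₂)
open import Function using (_∘_)
open import Relation.Nullary using (¬_; yes; no; contradiction)
open import Relation.Nullary.Decidable using (dec-true; dec-false)
open import Relation.Binary.PropositionalEquality using (_≡_; refl; sym; subst₂)

≤ᵇ-true : ∀ {m n} → m ≤ n → (m ≤ᵇ n) ≡ true
≤ᵇ-true = dec-true (_ ≤? _)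

≤ᵇ-false : ∀ {m n} → ¬ m ≤ n → (m ≤ᵇ n) ≡ false
≤ᵇ-false = dec-false (_ ≤? _)

<ᵇ-true : ∀ {m n} → m < n → (m <ᵇ n) ≡ true
<ᵇ-true = dec-true (_ <? _)

<ᵇ-false : ∀ {m n} → ¬ m < n → (m <ᵇ n) ≡ false
<ᵇ-false = dec-false (_ <? _)

Ascent : (ℕ → ℕ) → ℕ → Set
Ascent P j = P (j ∸ 1) < P j

EndsAt : List RefFactor → ℕ → Set
EndsAt F j = Any (λ f → start f + len f ≡ j) F

PeakReason : (ℕ → ℕ) → List RefFactor → ℕ → Set
PeakReason P F j = j ≡ 1 ⊎ Ascent P j ⊎ EndsAt F j

newReasonIsFactorEnd : ∀ {P Q F f j} → (Ascent Q j → Ascent P j) →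
                       PeakReason Q (f ∷ F) j → ¬ PeakReason P F j →
                       start f + len f ≡ j
newReasonIsFactorEnd _      (inj₁ j≡1)                ¬old = contradiction (inj₁ j≡1) ¬old
newReasonIsFactorEnd ascQ⇒P (inj₂ (inj₁ ascQ))         ¬old =
  contradiction (inj₂ (inj₁ (ascQ⇒P ascQ))) ¬old
newReasonIsFactorEnd _      (inj₂ (inj₂ (here ends)))  _    = ends
newReasonIsFactorEnd _      (inj₂ (inj₂ (there ends))) ¬old = contradiction (inj₂ (inj₂ ends)) ¬old

data Zone (i ℓ j : ℕ) : Set where
  farLeft  : j + ℓ < i → Zone i ℓ j
  damped   : j < i → i ≤ j + ℓ → Zone i ℓ j
  inside   : i ≤ j → j < i + ℓ → Zone i ℓ j
  atEnd    : j ≡ i + ℓ → Zone i ℓ j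
  beyond   : i + ℓ < j → Zone i ℓ j

zone : ∀ i ℓ j → Zone i ℓ j
zone i ℓ j with j <? i | i ≤? j + ℓ | j <? i + ℓ | j ≟ i + ℓ
... | yes j<i | yes i≤j+ℓ | _         | _         = damped j<i i≤j+ℓ
... | yes _   | no  i≰j+ℓ | _         | _         = farLeft (≰⇒> i≰j+ℓ)
... | no  j≮i | _         | yes j<i+ℓ | _         = inside (≮⇒≥ j≮i) j<i+ℓ
... | no  _   | _         | no  _     | yes j≡i+ℓ = atEnd j≡i+ℓ
... | no  _   | _         | no  j≮i+ℓ | no  j≢i+ℓ = beyond (≤∧≢⇒< (≮⇒≥ j≮i+ℓ) (j≢i+ℓ ∘ sym))

module Update (P : ℕ → ℕ) (i ℓ : ℕ) where

  P' : ℕ → ℕ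
  P' = updateP P i ℓ

  P'-farLeft : ∀ {j} → j + ℓ < i → P' j ≡ P j
  P'-farLeft {j} j+ℓ<i
    rewrite ≤ᵇ-false {i} {j} (<⇒≱ (≤-<-trans (m≤m+n j ℓ) j+ℓ<i))
          | ≤ᵇ-false {i} {j + ℓ} (<⇒≱ j+ℓ<i) = refl

  P'-damped : ∀ {j} → j < i → i ≤ j + ℓ → P' j ≡ P j ⊓ (i ∸ j)
  P'-damped {j} j<i i≤j+ℓ
    rewrite ≤ᵇ-false {i} {j} (<⇒≱ j<i)
          | ≤ᵇ-true {i} {j + ℓ} i≤j+ℓ
          | <ᵇ-true {j} {i} j<i = refl

  P'-inside : ∀ {j} → i ≤ j → j < i + ℓ → P' j ≡ 0
  P'-inside {j} i≤j j<i+ℓ rewrite ≤ᵇ-true i≤j | <ᵇ-true j<i+ℓ = refl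

  P'-right : ∀ {j} → i + ℓ ≤ j → P' j ≡ P j
  P'-right {j} i+ℓ≤j
    rewrite ≤ᵇ-true {i} {j} (≤-trans (m≤m+n i ℓ) i+ℓ≤j)
          | <ᵇ-false {j} {i + ℓ} (≤⇒≯ i+ℓ≤j)
          | ≤ᵇ-true {i} {j + ℓ} (≤-trans (m≤m+n i ℓ) (≤-trans i+ℓ≤j (m≤m+n j ℓ)))
          | <ᵇ-false {j} {i} (≤⇒≯ (≤-trans (m≤m+n i ℓ) i+ℓ≤j)) = refl

  P'-≤ : ∀ j → P' j ≤ P j
  P'-≤ j with zone i ℓ j
  ... | farLeft j+ℓ<i     = ≤-reflexive (P'-farLeft j+ℓ<i)
  ... | damped j<i i≤j+ℓ  = ≤-trans (≤-reflexive (P'-damped j<i i≤j+ℓ)) (m⊓n≤m (P j) (i ∸ j))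
  ... | inside i≤j j<i+ℓ  = ≤-trans (≤-reflexive (P'-inside i≤j j<i+ℓ)) z≤n
  ... | atEnd refl        = ≤-reflexive (P'-right ≤-refl)
  ... | beyond i+ℓ<j      = ≤-reflexive (P'-right (<⇒≤ i+ℓ<j))

  P'-≥-min : ∀ {j} → j < i → P j ⊓ (i ∸ j) ≤ P' j
  P'-≥-min {j} j<i with j + ℓ <? i
  ... | yes j+ℓ<i rewrite P'-farLeft j+ℓ<i = m⊓n≤m (P j) (i ∸ j)
  ... | no  j+ℓ≮i rewrite P'-damped j<i (≮⇒≥ j+ℓ≮i) = ≤-refl

  -- Left of i the update creates no ascent: rule D caps P at the
  -- decreasing function i - j, and far left P is unchanged.
  noAscent-left : ∀ {j} → j < i → P j ≤ P (j ∸ 1) → P' j ≤ P' (j ∸ 1)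
  noAscent-left {j} j<i Pj≤ with j + ℓ <? i
  ... | yes j+ℓ<i
    rewrite P'-farLeft j+ℓ<i
          | P'-farLeft {j ∸ 1} (≤-<-trans (+-monoˡ-≤ ℓ (m∸n≤m j 1)) j+ℓ<i) = Pj≤
  ... | no j+ℓ≮i = begin
    P' j                       ≡⟨ P'-damped j<i (≮⇒≥ j+ℓ≮i) ⟩
    P j ⊓ (i ∸ j)              ≤⟨ ⊓-mono-≤ Pj≤ (∸-monoʳ-≤ i (m∸n≤m j 1)) ⟩
    P (j ∸ 1) ⊓ (i ∸ (j ∸ 1))  ≤⟨ P'-≥-min (≤-<-trans (m∸n≤m j 1) j<i) ⟩
    P' (j ∸ 1)                 ∎
    where open ≤-Reasoning

  ascent-left : ∀ {j} → j < i → Ascent P' j → Ascent P j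
  ascent-left {j} j<i asc' with P (j ∸ 1) <? P j
  ... | yes asc  = asc
  ... | no  ¬asc = contradiction asc' (≤⇒≯ (noAscent-left j<i (≮⇒≥ ¬asc)))

  ascent-beyond : ∀ {j} → i + ℓ < j → Ascent P' j → Ascent P j
  ascent-beyond i+ℓ<j = subst₂ _<_ (P'-right (∸-monoˡ-≤ 1 i+ℓ<j)) (P'-right (<⇒≤ i+ℓ<j))

  newReason : ∀ {F r m j} → 0 < P' j → PeakReason P' (factor i ℓ r m ∷ F) j →
              ¬ PeakReason P F j → j ≡ i + ℓ
  newReason {j = j} 0<P'j new ¬old with zone i ℓ j
  ... | farLeft j+ℓ<i    =
    sym (newReasonIsFactorEnd {P} {P'} (ascent-left (≤-<-trans (m≤m+n j ℓ) j+ℓ<i)) new ¬old)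
  ... | damped j<i _     = sym (newReasonIsFactorEnd {P} {P'} (ascent-left j<i) new ¬old)
  ... | inside i≤j j<i+ℓ = contradiction (P'-inside i≤j j<i+ℓ) (>⇒≢ 0<P'j)
  ... | atEnd j≡i+ℓ      = j≡i+ℓ
  ... | beyond i+ℓ<j     = sym (newReasonIsFactorEnd {P} {P'} (ascent-beyond i+ℓ<j) new ¬old)

open Update using (P'-≤; newReason)

-- A peak after the update satisfies θ ≤ P' j ≤ P j, so if it was no peak
-- before, only its peak reason is new, and newReason locates it.
lemma4 : (T : List ℕ) → ValidText T → (θ : ℕ) → 2 ≤ θ →
         (s s' : State) → Reachable θ T s → (i : ℕ) → Step θ T i s s' →
         ∀ j → Peak θ T s' j → ¬ Peak θ T s j → j ≡ i + proj₁ s i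
lemma4 _ _ _ 2≤θ _ _ _ i (step {P} {F} _ _ _) j (isPos , θ≤P'j , new) notPeak =
  newReason P i (P i) 0<P'j new
    (λ old → notPeak (isPos , ≤-trans θ≤P'j (P'-≤ P i (P i) j) , old))
  where
  0<P'j : 0 < updateP P i (P i) j
  0<P'j = ≤-trans (≤-trans (s≤s z≤n) 2≤θ) θ≤P'j
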